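{- Let $C(i)$ denote the set of vertices colored $i$ in $G.$ If $G$ is DPG-$[k,2]$-colorable, then we have the followings: (1) $G$ is DP-$k$-colorable and thus $k$-choosable. (2) $G$ is DP-vertex-$\lceil{k/2} \rceil$-arborable. (3) Let $2d > k.$ If $L$ is a $d$-assignment for $G$ where $d\leq k$ and $1, 2, \ldots, 2d-k $ are colors, then we can find an $L$-forested-coloring such that $C(i)$ is an independent set for each $i \in \{1, \ldots, 2d-k\}.$
   Context: All graphs are finite, simple, undirected. An assignment $L$ gives each vertex $v$ a list $L(v)$ of colors, with $\bigcup_v L(v)\subseteq\{1,\ldots,s\}$; a $k$-assignment has $|L(v)|=k$ for all $v$. A cover $H$ of $G$ (with respect to $L$) is a graph with vertex set $\{(u,c): u\in V(G), c\in L(u)\}$ such that each $\{u\}\times L(u)$ induces a complete graph, for each edge $uv$ of $G$ the edges of $H$ between $\{u\}\times L(u)$ and $\{v\}\times L(v)$ form a (possibly empty) matching, and there are no such edges if $uv\notin E(G)$. A representative set of $(G,H)$ contains exactly one vertex from each $\{v\}\times L(v)$. $G$ is DP-$k$-colorable if for every $k$-assignment $L$ and every cover $H$ there is a representative set $R$ with $H[R]$ edgeless; $G$ is $k$-choosable if for every $k$-assignment $L$ there is a proper coloring with $c(v)\in L(v)$. $G$ is DP-vertex-$k$-arborable if for every $k$-assignment and every cover $H$ there is a representative set $R$ with $H[R]$ a forest. An $L$-forested-coloring chooses $c(v)\in L(v)$ for each $v$ so that each color class induces a forest. For $F=(f_1,\ldots,f_s)$ with each $f_i$ a function from $V(G)$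 to the nonnegative integers, a DP-$F$-coloring of $(G,H)$ is a representative set $R$ that can be ordered so that each element $(v,i)\in R$ has fewer than $f_i(v)$ neighbors (in $H$) among earlier elements of $R$. Write $|f(v)|=f_1(v)+\cdots+f_s(v)$. $G$ is DPG-$[k,t]$-colorable if $(G,H)$ has a DP-$F$-coloring for every cover $H$ and every $F$ such that $|f(v)|\geq k$ and $f_i(v)\leq t$ for every vertex $v$ and every $i$ with $1\leq i\leq s$. -}

module Defs where

open import Data.Nat using (ℕ; zero; suc; _+_; _≤_; _<_; _∸_; ⌈_/2⌉)
open import Data.Nat.Properties using (_<?_)
open import Data.Bool using (Bool; true; false; _∧_; if_then_else_)
open import Data.Fin using (Fin; zero; suc; toℕ; inject₁; fromℕ)
open import Data.Fin.Subset using (Subset; _∈_; ∣_∣; ⊤)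
open import Data.List using (List; map; allFin)
open import Data.Nat.ListAction using (sum)
open import Data.Product using (Σ; _×_; ∃; ∃-syntax; proj₁)
import Data.Unit
open import Relation.Binary.PropositionalEquality using (_≡_; _≢_)
open import Relation.Nullary using (¬_)
open import Relation.Nullary.Decidable using (⌊_⌋)
open import Function.Definitions using (Injective)

record Graph : Set where
  field
    n      : ℕ
    E      : Fin n → Fin n → Bool
    sym    : ∀ u v → E u v ≡ E v u
    irrefl : ∀ v → E v v ≡ false
open Graph public

-- Colors {1,…,s} are represented by Fin s (color j ↦ index j-1).
-- An assignment: each vertex gets a list (set) of colors.
Assignment : Graph → ℕ → Set
Assignment G s = Fin (n G) → Subset s

IsKAssignment : {G : Graph} {s : ℕ} → ℕ → Assignment G s → Set
IsKAssignment {G} k L = ∀ (v : Fin (n G)) → ∣ L v ∣ ≡ k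

-- A cover H of G with respect to L. Vertex (u , c) of H exists iff c ∈ L u;
-- HE u c v d = true means (u,c)(v,d) is an edge of H.
record Cover (G : Graph) (s : ℕ) (L : Assignment G s) : Set where
  field
    HE       : Fin (n G) → Fin s → Fin (n G) → Fin s → Bool
    onLists  : ∀ u c v d → HE u c v d ≡ true → (c ∈ L u) × (d ∈ L v)
    symH     : ∀ u c v d → HE u c v d ≡ HE v d u c
    irreflH  : ∀ u c → HE u c u c ≡ false
    clique   : ∀ u c d → c ∈ L u → d ∈ L u → c ≢ d → HE u c u d ≡ true
    nonEdge  : ∀ u v c d → u ≢ v → E G u v ≡ false → HE u c v d ≡ false
    matching : ∀ u v c d d' → u ≢ v → HE u c v d ≡ true → HE u c v d' ≡ true → d ≡ d'
open Cover public

-- A representative set: one vertex (v , r v) from each {v} × L(v).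
Representative : (G : Graph) (s : ℕ) → Assignment G s → Set
Representative G s L = Σ (Fin (n G) → Fin s) (λ r → ∀ v → r v ∈ L v)

count : {m : ℕ} → (Fin m → Bool) → ℕ
count {zero}  p = 0
count {suc m} p = (if p zero then 1 else 0) + count {m} (λ x → p (suc x))

sumFin : {s : ℕ} → (Fin s → ℕ) → ℕ
sumFin {s} f = sum (map f (allFin s))

HasCycle : {m : ℕ} → (Fin m → Fin m → Bool) → (Fin m → Set) → Set
HasCycle {m} A P =
  ∃[ l ] Σ (Fin (3 + l) → Fin m) (λ c →
      Injective _≡_ _≡_ c
    × (∀ j → P (c j))
    × (∀ (j : Fin (2 + l)) → A (c (inject₁ j)) (c (suc j)) ≡ true)
    × A (c (fromℕ (2 + l))) (c zero) ≡ true)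

EdgelessRep : {G : Graph} {s : ℕ} {L : Assignment G s} → Cover G s L → (Fin (n G) → Fin s) → Set
EdgelessRep {G} H r = ∀ (u v : Fin (n G)) → HE H u (r u) v (r v) ≡ false

ForestRep : {G : Graph} {s : ℕ} {L : Assignment G s} → Cover G s L → (Fin (n G) → Fin s) → Set
ForestRep {G} H r = ¬ HasCycle (λ u v → HE H u (r u) v (r v)) (λ _ → Data.Unit.⊤)

DP-colorable : Graph → ℕ → Set
DP-colorable G k = ∀ (s : ℕ) (L : Assignment G s) → IsKAssignment {G} {s} k L →
  (H : Cover G s L) → Σ (Representative G s L) (λ R → EdgelessRep H (proj₁ R))

choosable : Graph → ℕ → Set
choosable G k = ∀ (s : ℕ) (L : Assignment G s) → IsKAssignment {G} {s} k L →
  Σ (Fin (n G) → Fin s) (λ c → (∀ v → c v ∈ L v) ×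
     (∀ u v → E G u v ≡ true → c u ≢ c v))

DP-vertex-arborable : Graph → ℕ → Set
DP-vertex-arborable G k = ∀ (s : ℕ) (L : Assignment G s) → IsKAssignment {G} {s} k L →
  (H : Cover G s L) → Σ (Representative G s L) (λ R → ForestRep H (proj₁ R))

fullAssignment : (G : Graph) (s : ℕ) → Assignment G s
fullAssignment G s v = ⊤

-- DP-F-coloring of (G,H), F = (f_1,…,f_s) given as F i v = f_i(v):
-- a representative set r and an ordering (injective position map pos)
-- such that each (v, r v) has fewer than f_{r v}(v) H-neighbours among
-- earlier elements.
DP-F-coloring : {G : Graph} {s : ℕ} {L : Assignment G s} →
  Cover G s L → (Fin s → Fin (n G) → ℕ) → Set
DP-F-coloring {G} {s} {L} H F =
  Σ (Representative G s L) (λ R →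
  Σ (Fin (n G) → Fin (n G)) (λ pos →
      Injective _≡_ _≡_ pos
    × (∀ v → count (λ u → ⌊ toℕ (pos u) <? toℕ (pos v) ⌋
                           ∧ HE H v (proj₁ R v) u (proj₁ R u))
             < F (proj₁ R v) v)))

DPG-colorable : Graph → ℕ → ℕ → Set
DPG-colorable G k t = ∀ (s : ℕ) (H : Cover G s (fullAssignment G s))
  (F : Fin s → Fin (n G) → ℕ) →
  (∀ v → k ≤ sumFin (λ i → F i v)) →
  (∀ i v → F i v ≤ t) →
  DP-F-coloring H F

-- L-forested-coloring c where additionally the color classes C(i) for
-- colors i ∈ {1,…,m} (indices toℕ i < m) are independent.
ForestedColoringIndep : (G : Graph) (s : ℕ) → Assignment G s → ℕ → Set
ForestedColoringIndep G s L m =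
  Σ (Fin (n G) → Fin s) (λ c →
      (∀ v → c v ∈ L v)
    × (∀ (i : Fin s) → ¬ HasCycle (E G) (λ v → c v ≡ i))
    × (∀ (i : Fin s) → toℕ i < m → ∀ u v → c u ≡ i → c v ≡ i → E G u v ≡ false))

module Submission where

-- All parts come from one construction.  A conflict structure on G is a
-- symmetric, loopless relation between (vertex, colour) pairs of distinct
-- adjacent vertices which forms a matching on every edge; adding a clique on
-- each {v} × {1,…,s} turns it into a cover of G for the full assignment.
-- Feed this cover to DPG-[k,2]-colourability with f_i(v) = w(i) for i ∈ L(v)
-- and 0 otherwise, where w ≤ 2 and |f(v)| ≥ k.  In the resulting DP-F-colouring
--   * every chosen colour has positive weight, hence lies in the list;
--   * of two conflicting vertices the later one has an earlier neighbour,
--     so its colour has weight 2;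
--   * on a conflict cycle the latest vertex has two earlier neighbours and
--     would need weight 3, so there are no conflict cycles.
-- With w ≡ 1 there are no conflicts (part 1, using the cover itself or the
-- relation "adjacent with equal colour"), with w ≡ 2 the representatives
-- induce a forest (part 2), and with w = 1 on the colours below 2d−k and 2
-- elsewhere we get part (3).

open import Defs
open import Data.Nat using (ℕ; _≤_; _<_; _+_; _∸_; ⌈_/2⌉)
open import Data.Product using (_×_)

open import Data.Nat using (zero; suc; _*_; z≤n; s≤s; _<ᵇ_)
open import Data.Nat.Properties
  using (_<?_; ≤-trans; ≤-refl; ≤-reflexive; ≤∧≢⇒<; <⇒≢; <-cmp; m≤n+m; m<n+m; +-suc; *-comm;
         *-identityʳ; +-identityʳ; m∸n+n≡m; <⇒≤; +-cancelˡ-≤; m≤n⇒m≤1+n; <⇒<ᵇ;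
         module ≤-Reasoning)
open import Data.Nat.ListAction using (sum)
open import Data.Bool using (Bool; true; false; not; _∧_; if_then_else_)
open import Data.Bool.Properties using (∧-conicalʳ; T-≡)
open import Data.Fin using (Fin; toℕ; inject₁; fromℕ; _≟_)
  renaming (zero to fzero; suc to fsuc)
open import Data.Fin.Properties using (toℕ-injective; toℕ-inject₁)
open import Data.Fin.Relation.Unary.Top using (view; ‵fromℕ; ‵inject₁)
open import Data.Fin.Subset using (Subset; _∈_; ∣_∣; Side; inside; outside)
open import Data.Fin.Subset.Properties using (∈⊤)
open import Data.Vec using ([]; _∷_; lookup)
open import Data.Vec.Properties using (lookup⇒[]=)
open import Data.List using (map; tabulate; allFin)
open import Data.List.Properties using (map-tabulate)
open import Data.List.Extrema.Nat using (argmax; f[xs]≤f[argmax])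
open import Data.List.Membership.Propositional.Properties using (∈-allFin)
import Data.List.Relation.Unary.All as All
open import Data.Product using (Σ; _,_; proj₁; proj₂)
open import Data.Sum using (_⊎_; inj₁; inj₂; [_,_]′)
import Data.Sum as Sum
open import Data.Empty using (⊥-elim)
open import Data.Unit using (⊤; tt)
open import Function using (_∘_)
open import Function.Bundles using (mk⇔; Equivalence)
open import Relation.Binary using (tri<; tri≈; tri>)
open import Relation.Binary.PropositionalEquality
  using (_≡_; _≢_; refl; trans; cong; cong₂; subst; module ≡-Reasoning)
  renaming (sym to ≡-sym)
open import Relation.Nullary using (Dec; yes; no; ¬_; does)
open import Relation.Nullary.Decidable using (⌊_⌋; isYes≗does; dec-true; dec-false; does-⇔)

does-true : {A : Set} (a? : Dec A) → does a? ≡ true → A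
does-true (yes a) _ = a

2≰1 : ¬ (2 ≤ 1)
2≰1 (s≤s ())

3≰2 : ¬ (3 ≤ 2)
3≰2 (s≤s 2≤1) = 2≰1 2≤1

count-one : ∀ {m} (p : Fin m → Bool) x → p x ≡ true → 1 ≤ count p
count-one p fzero px rewrite px = s≤s z≤n
count-one p (fsuc x) px = ≤-trans (count-one (p ∘ fsuc) x px) (m≤n+m _ _)

count-two : ∀ {m} (p : Fin m → Bool) x y → x ≢ y → p x ≡ true → p y ≡ true → 2 ≤ count p
count-two p fzero fzero x≢y _ _ = ⊥-elim (x≢y refl)
count-two p fzero (fsuc y) _ px py rewrite px = s≤s (count-one (p ∘ fsuc) y py)
count-two p (fsuc x) fzero _ px py rewrite py = s≤s (count-one (p ∘ fsuc) x px)
count-two p (fsuc x) (fsuc y) x≢y px py =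
  ≤-trans (count-two (p ∘ fsuc) x y (x≢y ∘ cong fsuc) px py) (m≤n+m _ _)

sumFin-suc : ∀ {s} (f : Fin (suc s) → ℕ) → sumFin f ≡ f fzero + sumFin (f ∘ fsuc)
sumFin-suc f = begin
  sum (map f (allFin _))               ≡⟨ cong sum (map-tabulate (λ i → i) f) ⟩
  f fzero + sum (tabulate (f ∘ fsuc))  ≡⟨ cong (f fzero +_) (≡-sym (cong sum (map-tabulate (λ i → i) (f ∘ fsuc)))) ⟩
  f fzero + sumFin (f ∘ fsuc)          ∎
  where open ≡-Reasoning

keepIf : Side → ℕ → ℕ
keepIf inside  a = a
keepIf outside _ = 0

onList : ∀ {s} → Subset s → (Fin s → ℕ) → Fin s → ℕ
onList p w i = keepIf (lookup p i) (w i)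

onList-≤ : ∀ {s} (p : Subset s) (w : Fin s → ℕ) i → onList p w i ≤ w i
onList-≤ p w i with lookup p i
... | inside  = ≤-refl
... | outside = z≤n

onList-∈ : ∀ {s} (p : Subset s) (w : Fin s → ℕ) i → 1 ≤ onList p w i → i ∈ p
onList-∈ p w i positive with lookup p i in eq
... | inside = lookup⇒[]= i p eq

-- Needed for part (2): ⌈k/2⌉ colours of weight 2 have total at least k.
n≤⌈n/2⌉*2 : ∀ n → n ≤ ⌈ n /2⌉ * 2
n≤⌈n/2⌉*2 zero          = z≤n
n≤⌈n/2⌉*2 (suc zero)    = s≤s z≤n
n≤⌈n/2⌉*2 (suc (suc n)) = s≤s (s≤s (n≤⌈n/2⌉*2 n))

sum-onList-∷ : ∀ {s} x (p : Subset s) (w : Fin (suc s) → ℕ) →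
  sumFin (onList (x ∷ p) w) ≡ keepIf x (w fzero) + sumFin (onList p (w ∘ fsuc))
sum-onList-∷ x p w = sumFin-suc (onList (x ∷ p) w)

sum-onList-const : ∀ {s} (p : Subset s) c → sumFin (onList p (λ _ → c)) ≡ ∣ p ∣ * c
sum-onList-const []            c = refl
sum-onList-const (inside ∷ p)  c =
  trans (sum-onList-∷ inside p (λ _ → c)) (cong (c +_) (sum-onList-const p c))
sum-onList-const (outside ∷ p) c =
  trans (sum-onList-∷ outside p (λ _ → c)) (sum-onList-const p c)

lightBelow : ∀ {s} → ℕ → Fin s → ℕ
lightBelow m i = if toℕ i <ᵇ m then 1 else 2

lightBelow-light : ∀ {s} m (i : Fin s) → toℕ i < m → lightBelow m i ≡ 1
lightBelow-light m i i<m
  rewrite Equivalence.to T-≡ (<⇒<ᵇ {toℕ i} {m} i<m) = refl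

lightBelow-≤2 : ∀ {s} m (i : Fin s) → lightBelow m i ≤ 2
lightBelow-≤2 m i with toℕ i <ᵇ m
... | true  = s≤s z≤n
... | false = ≤-refl

-- At most m colours of a list are light, so the total is at least 2∣p∣ − m.
sum-onList-lightBelow : ∀ {s} (p : Subset s) m →
  ∣ p ∣ * 2 ≤ m + sumFin (onList p (lightBelow m))
sum-onList-lightBelow []            m       = z≤n
sum-onList-lightBelow (inside ∷ p)  zero    =
  subst (∣ inside ∷ p ∣ * 2 ≤_) (≡-sym (sum-onList-∷ inside p (lightBelow zero)))
    (s≤s (s≤s (sum-onList-lightBelow p zero)))
sum-onList-lightBelow (outside ∷ p) zero    =
  subst (∣ p ∣ * 2 ≤_) (≡-sym (sum-onList-∷ outside p (lightBelow zero)))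
    (sum-onList-lightBelow p zero)
sum-onList-lightBelow (inside ∷ p)  (suc m) = begin
  2 + ∣ p ∣ * 2         ≤⟨ s≤s (s≤s (sum-onList-lightBelow p m)) ⟩
  suc (suc (m + rest))  ≡⟨ cong suc (≡-sym (+-suc m rest)) ⟩
  suc m + suc rest      ≡⟨ cong (suc m +_) (≡-sym (sum-onList-∷ inside p (lightBelow (suc m)))) ⟩
  suc m + sumFin (onList (inside ∷ p) (lightBelow (suc m))) ∎
  where
  open ≤-Reasoning
  rest : ℕ
  rest = sumFin (onList p (lightBelow m))
sum-onList-lightBelow (outside ∷ p) (suc m) =
  subst (λ t → ∣ p ∣ * 2 ≤ suc m + t) (≡-sym (sum-onList-∷ outside p (lightBelow (suc m))))
    (m≤n⇒m≤1+n (sum-onList-lightBelow p m))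

maximiser : ∀ {m} (f : Fin (suc m) → ℕ) → Σ (Fin (suc m)) λ j → ∀ x → f x ≤ f j
maximiser f = argmax f fzero (allFin _) ,
  λ x → All.lookup (f[xs]≤f[argmax] {f = f} fzero (allFin _)) (∈-allFin x)

TwoNeighbours : ∀ {m k} (A : Fin m → Fin m → Bool) (c : Fin k → Fin m) (j : Fin k) → Set
TwoNeighbours {k = k} A c j = Σ (Fin k) λ a → Σ (Fin k) λ b →
  a ≢ b × A (c j) (c a) ≡ true × A (c j) (c b) ≡ true

cycle-neighbours : ∀ {m} (A : Fin m → Fin m → Bool) → (∀ u v → A u v ≡ A v u) →
  ∀ l (c : Fin (3 + l) → Fin m) →
  (∀ (j : Fin (2 + l)) → A (c (inject₁ j)) (c (fsuc j)) ≡ true) →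
  A (c (fromℕ (2 + l))) (c fzero) ≡ true →
  ∀ j → TwoNeighbours A c j
cycle-neighbours A symA l c step closing fzero =
  fsuc fzero , fromℕ (2 + l) , (λ ()) , step fzero , trans (symA _ _) closing
cycle-neighbours A symA l c step closing (fsuc j) with view j
... | ‵fromℕ     = fzero , inject₁ (fromℕ (suc l)) , (λ ()) , closing ,
                   trans (symA _ _) (step (fromℕ (suc l)))
... | ‵inject₁ i = inject₁ (inject₁ i) , fsuc (fsuc i) , pred≢succ ,
                   trans (symA _ _) (step (inject₁ i)) , step (fsuc i)
  where
  pred≢succ : inject₁ (inject₁ i) ≢ fsuc (fsuc i)
  pred≢succ eq = <⇒≢ (m<n+m (toℕ i) (s≤s z≤n))
    (trans (≡-sym (trans (toℕ-inject₁ (inject₁ i)) (toℕ-inject₁ i))) (cong toℕ eq))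

HasCycle-mono : ∀ {m} {A A' : Fin m → Fin m → Bool} {Q : Fin m → Set} →
  (∀ u v → Q u → Q v → A u v ≡ true → A' u v ≡ true) →
  HasCycle A Q → HasCycle A' (λ _ → ⊤)
HasCycle-mono A⊆A' (l , c , c-inj , c∈Q , step , closing) =
  l , c , c-inj , (λ _ → tt) ,
  (λ j → A⊆A' _ _ (c∈Q _) (c∈Q _) (step j)) , A⊆A' _ _ (c∈Q _) (c∈Q _) closing

module DP-F-Colouring {G : Graph} {s : ℕ} {L : Assignment G s}
  (H : Cover G s L) (F : Fin s → Fin (n G) → ℕ) (col : DP-F-coloring H F) where

  r : Fin (n G) → Fin s
  r = proj₁ (proj₁ col)

  pos : Fin (n G) → Fin (n G)
  pos = proj₁ (proj₂ col)

  RepEdge : Fin (n G) → Fin (n G) → Bool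
  RepEdge u v = HE H u (r u) v (r v)

  Before : Fin (n G) → Fin (n G) → Set
  Before u v = toℕ (pos u) < toℕ (pos v)

  earlierNeighbour : Fin (n G) → Fin (n G) → Bool
  earlierNeighbour v u = ⌊ toℕ (pos u) <? toℕ (pos v) ⌋ ∧ RepEdge v u

  few-earlier : ∀ v → count (earlierNeighbour v) < F (r v) v
  few-earlier = proj₂ (proj₂ (proj₂ col))

  RepEdge-distinct : ∀ {u v} → RepEdge u v ≡ true → u ≢ v
  RepEdge-distinct {u} e refl with trans (≡-sym e) (irreflH H u (r u))
  ... | ()

  pos-distinct : ∀ {u v} → u ≢ v → toℕ (pos u) ≢ toℕ (pos v)
  pos-distinct u≢v eq = u≢v (proj₁ (proj₂ (proj₂ col)) (toℕ-injective eq))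

  counted : ∀ {u v} → Before u v → RepEdge v u ≡ true → earlierNeighbour v u ≡ true
  counted {u} {v} u<v e = cong₂ _∧_ (trans (isYes≗does u<?v) (dec-true u<?v u<v)) e
    where
    u<?v : Dec (Before u v)
    u<?v = toℕ (pos u) <? toℕ (pos v)

  weight-positive : ∀ v → 1 ≤ F (r v) v
  weight-positive v = ≤-trans (s≤s z≤n) (few-earlier v)

  one-earlier : ∀ {u v} → Before u v → RepEdge v u ≡ true → 2 ≤ F (r v) v
  one-earlier {u} {v} u<v e =
    ≤-trans (s≤s (count-one (earlierNeighbour v) u (counted u<v e))) (few-earlier v)

  two-earlier : ∀ {x y v} → x ≢ y → Before x v → Before y v →
    RepEdge v x ≡ true → RepEdge v y ≡ true → 3 ≤ F (r v) v
  two-earlier {x} {y} {v} x≢y x<v y<v ex ey =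
    ≤-trans (s≤s (count-two (earlierNeighbour v) x y x≢y (counted x<v ex) (counted y<v ey)))
            (few-earlier v)

  edge-heavy : ∀ u v → RepEdge u v ≡ true → 2 ≤ F (r u) u ⊎ 2 ≤ F (r v) v
  edge-heavy u v e with <-cmp (toℕ (pos u)) (toℕ (pos v))
  ... | tri< u<v _ _ = inj₂ (one-earlier u<v (trans (symH H v (r v) u (r u)) e))
  ... | tri≈ _ eq _  = ⊥-elim (pos-distinct (RepEdge-distinct e) eq)
  ... | tri> _ _ v<u = inj₁ (one-earlier v<u e)

  -- The latest vertex of a cycle of H[R] has both cycle neighbours before it.
  cycle-heavy : HasCycle RepEdge (λ _ → ⊤) → Σ (Fin (n G)) λ v → 3 ≤ F (r v) v
  cycle-heavy (l , c , c-inj , _ , step , closing) =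
    from-latest (maximiser (λ x → toℕ (pos (c x))))
    where
    from-latest : Σ (Fin (3 + l)) (λ j → ∀ x → toℕ (pos (c x)) ≤ toℕ (pos (c j))) →
                  Σ (Fin (n G)) λ v → 3 ≤ F (r v) v
    from-latest (j , j-latest) = from-neighbours
      (cycle-neighbours RepEdge (λ u v → symH H u (r u) v (r v)) l c step closing j)
      where
      before-j : ∀ x → RepEdge (c j) (c x) ≡ true → Before (c x) (c j)
      before-j x e = ≤∧≢⇒< (j-latest x) (pos-distinct (RepEdge-distinct e ∘ ≡-sym))

      from-neighbours : TwoNeighbours RepEdge c j → Σ (Fin (n G)) λ v → 3 ≤ F (r v) v
      from-neighbours (a , b , a≢b , ea , eb) =
        c j , two-earlier (a≢b ∘ c-inj) (before-j a ea) (before-j b eb) ea eb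

record ConflictStructure (G : Graph) (s : ℕ) : Set where
  field
    conflict  : Fin (n G) → Fin s → Fin (n G) → Fin s → Bool
    symmetric : ∀ u c v d → conflict u c v d ≡ conflict v d u c
    loopless  : ∀ u c → conflict u c u c ≡ false
    onEdges   : ∀ u v c d → u ≢ v → E G u v ≡ false → conflict u c v d ≡ false
    matching  : ∀ u v c d d' → u ≢ v → conflict u c v d ≡ true → conflict u c v d' ≡ true → d ≡ d'
open ConflictStructure public

coverConflicts : ∀ {G s L} → Cover G s L → ConflictStructure G s
coverConflicts H = record
  { conflict  = HE H
  ; symmetric = symH H
  ; loopless  = irreflH H
  ; onEdges   = nonEdge H
  ; matching  = matching H
  }

-- Adjacent vertices with equal colours conflict; avoiding these conflicts is
-- proper colouring.
sameColour : (G : Graph) (s : ℕ) → ConflictStructure G s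
sameColour G s = record
  { conflict  = λ u c v d → E G u v ∧ does (c ≟ d)
  ; symmetric = λ u c v d → cong₂ _∧_ (sym G u v) (does-⇔ (mk⇔ ≡-sym ≡-sym) (c ≟ d) (d ≟ c))
  ; loopless  = λ u c → cong (_∧ does (c ≟ c)) (irrefl G u)
  ; onEdges   = λ u v c d _ e → cong (_∧ does (c ≟ d)) e
  ; matching  = λ u v c d d' _ e e' →
      trans (≡-sym (does-true (c ≟ d) (∧-conicalʳ _ _ e))) (does-true (c ≟ d') (∧-conicalʳ _ _ e'))
  }

sameColour-conflict : ∀ G {s u v} {c d : Fin s} → E G u v ≡ true → c ≡ d →
  conflict (sameColour G s) u c v d ≡ true
sameColour-conflict G {c = c} {d} e c≡d = cong₂ _∧_ e (dec-true (c ≟ d) c≡d)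

module FullCover {G : Graph} {s : ℕ} (C : ConflictStructure G s) where

  edge : Fin (n G) → Fin s → Fin (n G) → Fin s → Bool
  edge u c v d with u ≟ v
  ... | yes _ = not (does (c ≟ d))
  ... | no _  = conflict C u c v d

  edge-distinct : ∀ {u v} c d → u ≢ v → edge u c v d ≡ conflict C u c v d
  edge-distinct {u} {v} c d u≢v with u ≟ v
  ... | yes u≡v = ⊥-elim (u≢v u≡v)
  ... | no _    = refl

  edge-sym : ∀ u c v d → edge u c v d ≡ edge v d u c
  edge-sym u c v d with u ≟ v | v ≟ u
  ... | yes _   | yes _   = cong not (does-⇔ (mk⇔ ≡-sym ≡-sym) (c ≟ d) (d ≟ c))
  ... | yes u≡v | no v≢u  = ⊥-elim (v≢u (≡-sym u≡v))
  ... | no u≢v  | yes v≡u = ⊥-elim (u≢v (≡-sym v≡u))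
  ... | no _    | no _    = symmetric C u c v d

  edge-same : ∀ u c d → edge u c u d ≡ not (does (c ≟ d))
  edge-same u c d with u ≟ u
  ... | yes _ = refl
  ... | no u≢u = ⊥-elim (u≢u refl)

  cover : Cover G s (fullAssignment G s)
  cover = record
    { HE       = edge
    ; onLists  = λ _ _ _ _ _ → ∈⊤ , ∈⊤
    ; symH     = edge-sym
    ; irreflH  = λ u c → trans (edge-same u c c) (cong not (dec-true (c ≟ c) refl))
    ; clique   = λ u c d _ _ c≢d → trans (edge-same u c d) (cong not (dec-false (c ≟ d) c≢d))
    ; nonEdge  = λ u v c d u≢v e → trans (edge-distinct c d u≢v) (onEdges C u v c d u≢v e)
    ; matching = λ u v c d d' u≢v e e' → matching C u v c d d' u≢v
                   (trans (≡-sym (edge-distinct c d u≢v)) e) (trans (≡-sym (edge-distinct c d' u≢v)) e')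
    }

  edge-on-representatives : ∀ (r : Fin (n G) → Fin s) u v →
    edge u (r u) v (r v) ≡ conflict C u (r u) v (r v)
  edge-on-representatives r u v with u ≟ v
  ... | yes refl = trans (cong not (dec-true (r u ≟ r u) refl)) (≡-sym (loopless C u (r u)))
  ... | no _     = refl

-- The outcome of DPG-[k,2]-colourability for the cover built from a conflict
-- structure C with list weights w: a colouring from the lists in which every
-- conflict has an endpoint whose colour has weight 2, and the conflicts
-- between chosen colours contain no cycle.
record WeightedColouring {G : Graph} {s : ℕ} (C : ConflictStructure G s)
                         (L : Assignment G s) (w : Fin s → ℕ) : Set where
  field
    colour  : Fin (n G) → Fin s
    inList  : ∀ v → colour v ∈ L v
    heavy   : ∀ u v → conflict C u (colour u) v (colour v) ≡ true →
                2 ≤ w (colour u) ⊎ 2 ≤ w (colour v)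
    acyclic : ¬ HasCycle (λ u v → conflict C u (colour u) v (colour v)) (λ _ → ⊤)

weightedColouring : ∀ {G k s} → DPG-colorable G k 2 →
  (C : ConflictStructure G s) (L : Assignment G s) (w : Fin s → ℕ) →
  (∀ i → w i ≤ 2) → (∀ v → k ≤ sumFin (onList (L v) w)) → WeightedColouring C L w
weightedColouring {G} {k} {s} dpg C L w w≤2 total = record
  { colour  = r
  ; inList  = λ v → onList-∈ (L v) w (r v) (weight-positive v)
  ; heavy   = λ u v e → Sum.map (λ h → ≤-trans h (onList-≤ (L u) w (r u)))
                                (λ h → ≤-trans h (onList-≤ (L v) w (r v)))
                                (edge-heavy u v (conflict⇒edge u v tt tt e))
  ; acyclic = λ cyc → let (v , 3≤f) = cycle-heavy (HasCycle-mono conflict⇒edge cyc)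
                      in 3≰2 (≤-trans 3≤f (F≤2 (r v) v))
  }
  where
  open FullCover C

  F : Fin s → Fin (n G) → ℕ
  F i v = onList (L v) w i

  F≤2 : ∀ i v → F i v ≤ 2
  F≤2 i v = ≤-trans (onList-≤ (L v) w i) (w≤2 i)

  open DP-F-Colouring cover F (dpg s cover F total F≤2)

  -- Conflicts between chosen colours are edges of H[R] (the ⊤ arguments fit HasCycle-mono).
  conflict⇒edge : ∀ u v → ⊤ → ⊤ →
    conflict C u (r u) v (r v) ≡ true → RepEdge u v ≡ true
  conflict⇒edge u v _ _ e = trans (edge-on-representatives r u v) e

no-heavy-unit : ¬ (2 ≤ 1 ⊎ 2 ≤ 1)
no-heavy-unit = [ 2≰1 , 2≰1 ]′

unit-total : ∀ {G s k} (L : Assignment G s) → IsKAssignment {G} {s} k L →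
  ∀ v → k ≤ sumFin (onList (L v) (λ _ → 1))
unit-total L |L|≡k v =
  ≤-reflexive (≡-sym (trans (sum-onList-const (L v) 1) (trans (*-identityʳ _) (|L|≡k v))))

DPG⇒DP-colorable : ∀ G k → DPG-colorable G k 2 → DP-colorable G k
DPG⇒DP-colorable G k dpg s L |L|≡k H = (colour , inList) , edgeless
  where
  open WeightedColouring
    (weightedColouring dpg (coverConflicts H) L (λ _ → 1) (λ _ → s≤s z≤n) (unit-total {G} L |L|≡k))

  edgeless : EdgelessRep H colour
  edgeless u v with HE H u (colour u) v (colour v) in e
  ... | false = refl
  ... | true  = ⊥-elim (no-heavy-unit (heavy u v e))

DPG⇒choosable : ∀ G k → DPG-colorable G k 2 → choosable G k
DPG⇒choosable G k dpg s L |L|≡k = colour , inList , proper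
  where
  open WeightedColouring
    (weightedColouring dpg (sameColour G s) L (λ _ → 1) (λ _ → s≤s z≤n) (unit-total {G} L |L|≡k))

  proper : ∀ u v → E G u v ≡ true → colour u ≢ colour v
  proper u v e same = no-heavy-unit (heavy u v (sameColour-conflict G e same))

DPG⇒DP-vertex-arborable : ∀ G k → DPG-colorable G k 2 → DP-vertex-arborable G ⌈ k /2⌉
DPG⇒DP-vertex-arborable G k dpg s L |L|≡⌈k/2⌉ H = (colour , inList) , acyclic
  where
  total : ∀ v → k ≤ sumFin (onList (L v) (λ _ → 2))
  total v = subst (k ≤_)
    (≡-sym (trans (sum-onList-const (L v) 2) (cong (_* 2) (|L|≡⌈k/2⌉ v)))) (n≤⌈n/2⌉*2 k)

  open WeightedColouring
    (weightedColouring dpg (coverConflicts H) L (λ _ → 2) (λ _ → ≤-refl) total)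

DPG⇒forested : ∀ G k → DPG-colorable G k 2 →
  ∀ (d s : ℕ) (L : Assignment G s) → IsKAssignment {G} {s} d L →
  k < d + d → d ≤ k → (d + d) ∸ k ≤ s → ForestedColoringIndep G s L ((d + d) ∸ k)
DPG⇒forested G k dpg d s L |L|≡d k<2d _ _ = colour , inList , forest , independent
  where
  m : ℕ
  m = (d + d) ∸ k

  total : ∀ v → k ≤ sumFin (onList (L v) (lightBelow m))
  total v = +-cancelˡ-≤ m k _ (begin
    m + k                                   ≡⟨ m∸n+n≡m (<⇒≤ k<2d) ⟩
    d + d                                   ≡⟨ cong (d +_) (≡-sym (+-identityʳ d)) ⟩
    2 * d                                   ≡⟨ *-comm 2 d ⟩
    d * 2                                   ≡⟨ cong (_* 2) (≡-sym (|L|≡d v)) ⟩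
    ∣ L v ∣ * 2                             ≤⟨ sum-onList-lightBelow (L v) m ⟩
    m + sumFin (onList (L v) (lightBelow m)) ∎)
    where open ≤-Reasoning

  open WeightedColouring
    (weightedColouring dpg (sameColour G s) L (lightBelow m) (lightBelow-≤2 m) total)

  class-conflict : ∀ {i} u v → colour u ≡ i → colour v ≡ i → E G u v ≡ true →
    conflict (sameColour G s) u (colour u) v (colour v) ≡ true
  class-conflict u v cu≡i cv≡i e = sameColour-conflict G e (trans cu≡i (≡-sym cv≡i))

  forest : ∀ i → ¬ HasCycle (E G) (λ v → colour v ≡ i)
  forest i cyc = acyclic (HasCycle-mono class-conflict cyc)

  light : ∀ {i} x → toℕ i < m → colour x ≡ i → ¬ (2 ≤ lightBelow m (colour x))
  light {i} x i<m refl heavy-x = 2≰1 (subst (2 ≤_) (lightBelow-light m i i<m) heavy-x)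

  independent : ∀ i → toℕ i < m → ∀ u v → colour u ≡ i → colour v ≡ i → E G u v ≡ false
  independent i i<m u v cu≡i cv≡i with E G u v in e
  ... | false = refl
  ... | true  = ⊥-elim ([ light u i<m cu≡i , light v i<m cv≡i ]′
                          (heavy u v (class-conflict u v cu≡i cv≡i e)))

lemma1 : (G : Graph) (k : ℕ) → DPG-colorable G k 2 →
    (DP-colorable G k × choosable G k)
    × DP-vertex-arborable G ⌈ k /2⌉
    × (∀ (d s : ℕ) (L : Assignment G s) → IsKAssignment {G} {s} d L →
         k < d + d → d ≤ k → (d + d) ∸ k ≤ s →
         ForestedColoringIndep G s L ((d + d) ∸ k))
lemma1 G k dpg =
  (DPG⇒DP-colorable G k dpg , DPG⇒choosable G k dpg) ,
  DPG⇒DP-vertex-arborable G k dpg ,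
  DPG⇒forested G k dpg
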